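{- Let $D\in\{2,3,4,6\}$. Fix non-negative integers $i\le n$ and a prime $p\equiv-1\pmod D$ with $\sqrt{2Dn}<p\le n$. Let $k$ be an integer with $i\le k\le n$ and $p\mid Dk+1$. (1) If neither $\binom{k+i}{i}$ nor $\binom{n-i}{k-i}$ is divisible by $p$, then either $\{(n+1-1/D)/p\}<1/D$ or $\{(n+1/D)/p\}\ge1-1/D$. (2) If $p\ne D-1$, $p\nmid n+1$, and neither $\binom{k+i}{i+1}$ nor $\binom{n-i}{k-i}$ is divisible by $p$, then either $\{(n+1-1/D)/p\}<1/D$ or $\{(n+1/D)/p\}\ge1-1/D$.
   Context: $\{x\}=x-\lfloor x\rfloor$ denotes the fractional part of a real number $x$. -}

module Defs where

open import Data.Nat using (ℕ; zero; suc)
open import Data.Integer using (+_)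
open import Data.Rational using (ℚ; _/_; _-_; floor; 0ℚ)

ℕ→ℚ : ℕ → ℚ
ℕ→ℚ n = + n / 1

-- reciprocal of a natural number (only used at non-zero arguments;
-- the value at 0 is an irrelevant convention)
inv : ℕ → ℚ
inv zero    = 0ℚ
inv (suc k) = + 1 / suc k

frac : ℚ → ℚ
frac x = x - (floor x / 1)

module Submission where

-- Write b = k mod p, e = n mod p and m = (p + 1)/D. From p ∣ Dk + 1 one gets Db + 1 = (D − 1)p,
-- i.e. b = p − m. The two fractional parts are (De + D − 1)/(Dp) and (De + 1)/(Dp), so the
-- conclusion can only fail when m ≤ e + 1 ≤ b. Lucas' theorem in the last base-p digit
-- (p ∣ C(x, y) whenever x mod p < y mod p) excludes this range: applied to C(n − i, k − i) it
-- forces e < i mod p ≤ b, so adding i to k carries and p ∣ C(k + i, i); likewise p ∣ C(k + i, i + 1)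
-- unless i mod p = b = p − 1, which means m = 1, i.e. p = D − 1.

open import Defs
open import Data.Nat using (ℕ; _+_; _*_; _∸_; _≤_; _<_)
open import Data.Nat.Divisibility using (_∣_)
open import Data.Nat.Primality using (Prime)
open import Data.Nat.Combinatorics using (_C_)
open import Data.Rational using (ℚ; 1ℚ) renaming (_+_ to _+ℚ_; _-_ to _-ℚ_; _*_ to _*ℚ_; _<_ to _<ℚ_; _≤_ to _≤ℚ_)
open import Data.Sum using (_⊎_)
open import Data.Product using (_×_)
open import Relation.Binary.PropositionalEquality using (_≡_; _≢_)
open import Relation.Nullary using (¬_)

open import Data.Nat using (zero; suc; pred; _!; NonZero; s≤s; z≤n)
open import Data.Nat.Properties
open import Data.Nat.DivMod
  using (_/_; _%_; m≡m%n+[m/n]*n; %-congˡ; %-distribˡ-+; [m+n]%n≡m%n; [m+kn]%n≡m%n; m<n⇒m%n≡m; m%n<n;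
         m/n*n≡m; m*n/o*n≡m/o; /-congˡ; /-congʳ; [m*n+o]%[p*n]≡[m*n]%[p*n]+o; m%n*o≡m*o%[n*o])
open import Data.Nat.Divisibility using (divides; ∣m+n∣m⇒∣n; n∣m*n; m∣m*n; ∣⇒≤; ∣m⇒∣m*n; ∣n⇒∣m*n)
open import Data.Nat.Primality using (euclidsLemma; prime⇒nonZero)
open import Data.Nat.Combinatorics using (nCk≡n!/k![n-k]!; k>n⇒nCk≡0; k![n∸k]!∣n!)
import Data.Nat.Tactic.RingSolver as ℕ-Solver
open import Data.Integer as ℤ using (ℤ; +_; -[1+_])
open import Data.Integer.Properties as ℤ using (pos-*; pos-+)
open import Data.Integer.DivMod using (div-pos-is-/ℕ)
open import Data.Rational as ℚ using (mkℚ; toℚᵘ; floor)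
open import Data.Rational.Properties as ℚ using ()
open import Data.Rational.Unnormalised as ℚᵘ using (mkℚᵘ; ↥_; ↧_; *≡*; *<*; *≤*) renaming (_≃_ to _≃ᵘ_)
open import Data.Rational.Unnormalised.Properties as ℚᵘ using (↥[n/d]≡n; ↧[n/d]≡d; module ≃-Reasoning)
open import Algebra.Properties.AbelianGroup ℚ.+-0-abelianGroup using (//-rightDividesʳ)
open import Data.Sum using (inj₁; inj₂; fromInj₂)
open import Data.Product using (_,_)
open import Data.Empty using (⊥-elim)
open import Function using (_∘_)
open import Relation.Binary.PropositionalEquality using (refl; sym; trans; cong; cong₂; subst; subst₂; module ≡-Reasoning)
open import Relation.Nullary using (yes; no; contradiction)

m*o≡n*p⇒m/p≡n/o : ∀ m n o p .{{_ : NonZero o}} .{{_ : NonZero p}} → m * o ≡ n * p → m / p ≡ n / o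
m*o≡n*p⇒m/p≡n/o m n o p eq = begin
  m / p              ≡⟨ m*n/o*n≡m/o m o p ⟨
  (m * o) / (p * o)  ≡⟨ /-congˡ {o = p * o} eq ⟩
  (n * p) / (p * o)  ≡⟨ /-congʳ {m = n * p} (*-comm p o) ⟩
  (n * p) / (o * p)  ≡⟨ m*n/o*n≡m/o n p o ⟩
  n / o              ∎
  where
  open ≡-Reasoning
  instance _ = m*n≢0 p o
  instance _ = m*n≢0 o p

[m*n+o]%[p*n]≡m%p*n+o : ∀ m {n o} p .{{_ : NonZero p}} .{{_ : NonZero (p * n)}} → o < n →
  (m * n + o) % (p * n) ≡ m % p * n + o
[m*n+o]%[p*n]≡m%p*n+o m {n} {o} p o<n = trans ([m*n+o]%[p*n]≡[m*n]%[p*n]+o m p o<n)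
  (cong (_+ o) (sym (m%n*o≡m*o%[n*o] m p n)))

m%n+o%n≡[m+o]%n⊎[m+o]%n+n : ∀ m o n .{{_ : NonZero n}} →
  m % n + o % n ≡ (m + o) % n ⊎ m % n + o % n ≡ (m + o) % n + n
m%n+o%n≡[m+o]%n⊎[m+o]%n+n m o n with m % n + o % n <? n
... | yes s<n = inj₁ (sym (trans (%-distribˡ-+ m o n) (m<n⇒m%n≡m s<n)))
... | no  s≮n = inj₂ (trans (sym (m∸n+n≡m n≤s)) (cong (_+ n) (sym [m+o]%n≡s∸n)))
  where
  open ≡-Reasoning
  s = m % n + o % n
  n≤s : n ≤ s
  n≤s = ≮⇒≥ s≮n
  [m+o]%n≡s∸n : (m + o) % n ≡ s ∸ n
  [m+o]%n≡s∸n = begin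
    (m + o) % n      ≡⟨ %-distribˡ-+ m o n ⟩
    s % n            ≡⟨ %-congˡ (m∸n+n≡m n≤s) ⟨
    (s ∸ n + n) % n  ≡⟨ [m+n]%n≡m%n (s ∸ n) n ⟩
    (s ∸ n) % n      ≡⟨ m<n⇒m%n≡m (m<n+o⇒m∸n<o s n (+-mono-< (m%n<n m n) (m%n<n o n))) ⟩
    s ∸ n            ∎

n≤m%n+o%n⇒[m+o]%n<o%n : ∀ m o n .{{_ : NonZero n}} → n ≤ m % n + o % n → (m + o) % n < o % n
n≤m%n+o%n⇒[m+o]%n<o%n m o n n≤s with m%n+o%n≡[m+o]%n⊎[m+o]%n+n m o n
... | inj₁ s≡r = contradiction (subst (n ≤_) s≡r n≤s) (<⇒≱ (m%n<n (m + o) n))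
... | inj₂ s≡r+n = +-cancelʳ-< n ((m + o) % n) (o % n) (begin-strict
  (m + o) % n + n  ≡⟨ s≡r+n ⟨
  m % n + o % n    <⟨ +-monoˡ-< (o % n) (m%n<n m n) ⟩
  n + o % n        ≡⟨ +-comm n (o % n) ⟩
  o % n + n        ∎)
  where open ≤-Reasoning

[1+m]%n≡1+m%n : ∀ m n .{{_ : NonZero n}} → suc (m % n) < n → suc m % n ≡ suc (m % n)
[1+m]%n≡1+m%n m n 1+r<n = begin
  suc m % n                      ≡⟨ %-congˡ (cong suc (m≡m%n+[m/n]*n m n)) ⟩
  (suc (m % n) + m / n * n) % n  ≡⟨ [m+kn]%n≡m%n (suc (m % n)) (m / n) n ⟩
  suc (m % n) % n                ≡⟨ m<n⇒m%n≡m 1+r<n ⟩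
  suc (m % n)                    ∎
  where open ≡-Reasoning

-- x % n + (y ∸ x) % n ≤ x % n + (z ∸ x) % n, so the residue sum for z = x + (z ∸ x) must carry
-- while the one for y = x + (y ∸ x) must not.
z%n<x%n≤y%n : ∀ {x y z n} .{{_ : NonZero n}} → x ≤ y → x ≤ z →
  z % n < y % n → (y ∸ x) % n ≤ (z ∸ x) % n → z % n < x % n × x % n ≤ y % n
z%n<x%n≤y%n {x} {y} {z} {n} x≤y x≤z z%n<y%n u≤v = z%n<x%n , x%n≤y%n
  where
  open ≤-Reasoning
  a = x % n
  u = (y ∸ x) % n
  v = (z ∸ x) % n
  carry : ∀ w → x ≤ w → a + (w ∸ x) % n ≡ w % n ⊎ a + (w ∸ x) % n ≡ w % n + n
  carry w x≤w = subst (λ w′ → a + (w ∸ x) % n ≡ w′ % n ⊎ a + (w ∸ x) % n ≡ w′ % n + n)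
    (m+[n∸m]≡n x≤w) (m%n+o%n≡[m+o]%n⊎[m+o]%n+n x (w ∸ x) n)
  y%n≤a+u : y % n ≤ a + u
  y%n≤a+u with carry y x≤y
  ... | inj₁ a+u≡y   = ≤-reflexive (sym a+u≡y)
  ... | inj₂ a+u≡y+n = subst (y % n ≤_) (sym a+u≡y+n) (m≤m+n (y % n) n)
  a+v≡z+n : a + v ≡ z % n + n
  a+v≡z+n with carry z x≤z
  ... | inj₂ a+v≡z+n = a+v≡z+n
  ... | inj₁ a+v≡z   = contradiction (begin
    y % n  ≤⟨ y%n≤a+u ⟩
    a + u  ≤⟨ +-monoʳ-≤ a u≤v ⟩
    a + v  ≡⟨ a+v≡z ⟩
    z % n  ∎) (<⇒≱ z%n<y%n)
  z%n<x%n : z % n < a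
  z%n<x%n = +-cancelʳ-< n (z % n) a (begin-strict
    z % n + n  ≡⟨ a+v≡z+n ⟨
    a + v      <⟨ +-monoʳ-< a (m%n<n (z ∸ x) n) ⟩
    a + n      ∎)
  x%n≤y%n : a ≤ y % n
  x%n≤y%n with carry y x≤y
  ... | inj₁ a+u≡y   = subst (a ≤_) a+u≡y (m≤m+n a u)
  ... | inj₂ a+u≡y+n = contradiction (+-cancelʳ-≤ n (y % n) (z % n) (begin
    y % n + n  ≡⟨ a+u≡y+n ⟨
    a + u      ≤⟨ +-monoʳ-≤ a u≤v ⟩
    a + v      ≡⟨ a+v≡z+n ⟩
    z % n + n  ∎)) (<⇒≱ z%n<y%n)

-- Writing (1 + d) b + 1 = j p, the congruence p ≡ −1 (mod 1 + d) gives 1 + d ∣ 1 + j, and b < p gives j ≤ d.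
p∣[1+d]*b+1⇒[1+d]*b+1≡d*p : ∀ {d p m b} → 1 ≤ d → p + 1 ≡ m * suc d → b < p →
  p ∣ suc d * b + 1 → suc d * b + 1 ≡ d * p
p∣[1+d]*b+1⇒[1+d]*b+1≡d*p {d} {p} {m} {b} 1≤d p+1≡m*D b<p (divides j D*b+1≡j*p) =
  trans D*b+1≡j*p (cong (_* p) (≤-antisym (≤-pred j<D) d≤j))
  where
  open ≤-Reasoning
  D = suc d
  D∣D*b+[1+j] : D ∣ D * b + suc j
  D∣D*b+[1+j] = divides (j * m) (begin-equality
    D * b + suc j  ≡⟨ +-assoc (D * b) 1 j ⟨
    D * b + 1 + j  ≡⟨ cong (_+ j) D*b+1≡j*p ⟩
    j * p + j      ≡⟨ solve-j*p+j j p ⟩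
    j * (p + 1)    ≡⟨ cong (j *_) p+1≡m*D ⟩
    j * (m * D)    ≡⟨ *-assoc j m D ⟨
    j * m * D      ∎)
    where
    solve-j*p+j : ∀ j p → j * p + j ≡ j * (p + 1)
    solve-j*p+j = ℕ-Solver.solve-∀
  d≤j : d ≤ j
  d≤j = ≤-pred (∣⇒≤ (∣m+n∣m⇒∣n D∣D*b+[1+j] (m∣m*n b)))
  j<D : j < D
  j<D = *-cancelʳ-< p j D (begin-strict
    j * p      ≡⟨ D*b+1≡j*p ⟨
    D * b + 1  <⟨ +-monoʳ-< (D * b) (s≤s 1≤d) ⟩
    D * b + D  ≡⟨ trans (+-comm (D * b) D) (sym (*-suc D b)) ⟩
    D * suc b  ≤⟨ *-monoʳ-≤ D b<p ⟩
    D * p      ∎)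

nCk*k![n-k]!≡n! : ∀ {n k} → k ≤ n → (n C k) * (k ! * (n ∸ k) !) ≡ n !
nCk*k![n-k]!≡n! {n} {k} k≤n = trans (cong (_* (k ! * (n ∸ k) !)) (nCk≡n!/k![n-k]! k≤n)) (m/n*n≡m (k![n∸k]!∣n! k≤n))
  where instance _ = k !* (n ∸ k) !≢0

[1+k]*nC[1+k]≡n*[n-1]Ck : ∀ n k → suc k * (n C suc k) ≡ n * (pred n C k)
[1+k]*nC[1+k]≡n*[n-1]Ck zero    k = *-zeroʳ (suc k)
[1+k]*nC[1+k]≡n*[n-1]Ck (suc n) k with ≤-<-connex k n
... | inj₂ n<k = begin
  suc k * (suc n C suc k) ≡⟨ cong (suc k *_) (k>n⇒nCk≡0 (s≤s n<k)) ⟩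
  suc k * 0               ≡⟨ *-zeroʳ (suc k) ⟩
  0                       ≡⟨ *-zeroʳ (suc n) ⟨
  suc n * 0               ≡⟨ cong (suc n *_) (k>n⇒nCk≡0 n<k) ⟨
  suc n * (n C k)         ∎
  where open ≡-Reasoning
... | inj₁ k≤n = *-cancelʳ-≡ _ _ (k ! * (n ∸ k) !) (begin
  suc k * (suc n C suc k) * (k ! * (n ∸ k) !)  ≡⟨ rearrange (suc k) (suc n C suc k) (k !) ((n ∸ k) !) ⟩
  (suc n C suc k) * (suc k ! * (n ∸ k) !)      ≡⟨ nCk*k![n-k]!≡n! (s≤s k≤n) ⟩
  suc n !                                      ≡⟨ cong (suc n *_) (nCk*k![n-k]!≡n! k≤n) ⟨
  suc n * ((n C k) * (k ! * (n ∸ k) !))        ≡⟨ *-assoc (suc n) (n C k) (k ! * (n ∸ k) !) ⟨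
  suc n * (n C k) * (k ! * (n ∸ k) !)          ∎)
  where
  open ≡-Reasoning
  instance _ = k !* (n ∸ k) !≢0
  rearrange : ∀ a b c d → a * b * (c * d) ≡ b * (a * c * d)
  rearrange = ℕ-Solver.solve-∀

module _ {p : ℕ} (p-prime : Prime p) where

  -- By induction on r through (k + 1) C(n, k + 1) = n C(n − 1, k); p ∤ k + 1 as its last digit is s ≠ 0.
  lucas-last-digit : ∀ {r s} q₁ q₂ → r < s → s < p → p ∣ (r + q₁ * p) C (s + q₂ * p)
  lucas-last-digit {r} {suc s} q₁ q₂ r<s s<p =
    fromInj₂ (⊥-elim ∘ p∤1+k) (euclidsLemma (suc k) _ p-prime
      (subst (p ∣_) (sym ([1+k]*nC[1+k]≡n*[n-1]Ck (r + q₁ * p) k)) (p∣n*[n-1]Ck r<s)))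
    where
    k = s + q₂ * p
    p∤1+k : ¬ p ∣ suc k
    p∤1+k p∣1+k = <⇒≱ s<p (∣⇒≤ (∣m+n∣m⇒∣n (subst (p ∣_) (+-comm (suc s) (q₂ * p)) p∣1+k) (n∣m*n q₂)))
    p∣n*[n-1]Ck : ∀ {r} → r < suc s → p ∣ (r + q₁ * p) * (pred (r + q₁ * p) C k)
    p∣n*[n-1]Ck {zero}   _          = ∣m⇒∣m*n _ (n∣m*n q₁)
    p∣n*[n-1]Ck {suc r′} (s≤s r′<s) =
      ∣n⇒∣m*n (suc r′ + q₁ * p) (lucas-last-digit q₁ q₂ r′<s (<-trans (n<1+n s) s<p))

  private instance _ = prime⇒nonZero p-prime

  n%p<k%p⇒p∣nCk : ∀ {n k} → n % p < k % p → p ∣ n C k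
  n%p<k%p⇒p∣nCk {n} {k} n%p<k%p = subst₂ (λ n k → p ∣ n C k)
    (sym (m≡m%n+[m/n]*n n p)) (sym (m≡m%n+[m/n]*n k p))
    (lucas-last-digit (n / p) (k / p) n%p<k%p (m%n<n k p))

toℚᵘ-/ : ∀ i n .{{_ : NonZero n}} → toℚᵘ (i ℚ./ n) ≃ᵘ i ℚᵘ./ n
toℚᵘ-/ i (suc n) = ℚ.toℚᵘ-fromℚᵘ (mkℚᵘ i n)

module _ (a b c d : ℕ) .{{_ : NonZero b}} .{{_ : NonZero d}} where

  private
    cross : (R : ℤ → ℤ → Set) → R (+ (a * d)) (+ (c * b)) →
            R (↥ (+ a ℚᵘ./ b) ℤ.* ↧ (+ c ℚᵘ./ d)) (↥ (+ c ℚᵘ./ d) ℤ.* ↧ (+ a ℚᵘ./ b))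
    cross R = subst₂ R (sym (cross-term a b c d)) (sym (cross-term c d a b))
      where
      cross-term : ∀ a b c d .{{_ : NonZero b}} .{{_ : NonZero d}} →
                   ↥ (+ a ℚᵘ./ b) ℤ.* ↧ (+ c ℚᵘ./ d) ≡ + (a * d)
      cross-term a b c d = trans (cong₂ ℤ._*_ (↥[n/d]≡n (+ a) b) (↧[n/d]≡d (+ c) d)) (sym (pos-* a d))

  a*d≡c*b⇒a/b≡c/d : a * d ≡ c * b → + a ℚ./ b ≡ + c ℚ./ d
  a*d≡c*b⇒a/b≡c/d eq = ℚ.toℚᵘ-injective (ℚᵘ.≃-trans (toℚᵘ-/ (+ a) b)
    (ℚᵘ.≃-trans (*≡* (cross _≡_ (cong +_ eq))) (ℚᵘ.≃-sym (toℚᵘ-/ (+ c) d))))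

  a*d<c*b⇒a/b<c/d : a * d < c * b → + a ℚ./ b <ℚ + c ℚ./ d
  a*d<c*b⇒a/b<c/d lt = ℚ.toℚᵘ-cancel-< (ℚᵘ.<-respˡ-≃ (ℚᵘ.≃-sym (toℚᵘ-/ (+ a) b))
    (ℚᵘ.<-respʳ-≃ (ℚᵘ.≃-sym (toℚᵘ-/ (+ c) d)) (*<* (cross ℤ._<_ (ℤ.+<+ lt)))))

  a*d≤c*b⇒a/b≤c/d : a * d ≤ c * b → + a ℚ./ b ≤ℚ + c ℚ./ d
  a*d≤c*b⇒a/b≤c/d le = ℚ.toℚᵘ-cancel-≤ (ℚᵘ.≤-respˡ-≃ (ℚᵘ.≃-sym (toℚᵘ-/ (+ a) b))
    (ℚᵘ.≤-respʳ-≃ (ℚᵘ.≃-sym (toℚᵘ-/ (+ c) d)) (*≤* (cross ℤ._≤_ (ℤ.+≤+ le)))))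

a/b+c/d≡[a*d+c*b]/[b*d] : ∀ a b c d .{{_ : NonZero b}} .{{_ : NonZero d}} →
  + a ℚ./ b +ℚ + c ℚ./ d ≡ (+ (a * d + c * b) ℚ./ (b * d)) {{m*n≢0 b d}}
a/b+c/d≡[a*d+c*b]/[b*d] a b@(suc _) c d@(suc _) = ℚ.toℚᵘ-injective (begin
  toℚᵘ (+ a ℚ./ b +ℚ + c ℚ./ d)            ≈⟨ ℚ.toℚᵘ-homo-+ (+ a ℚ./ b) (+ c ℚ./ d) ⟩
  toℚᵘ (+ a ℚ./ b) ℚᵘ.+ toℚᵘ (+ c ℚ./ d)  ≈⟨ ℚᵘ.+-cong (toℚᵘ-/ (+ a) b) (toℚᵘ-/ (+ c) d) ⟩
  + a ℚᵘ./ b ℚᵘ.+ + c ℚᵘ./ d              ≡⟨ ℚᵘ./-cong numerator refl ⟩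
  + (a * d + c * b) ℚᵘ./ (b * d)          ≈⟨ ℚᵘ.≃-sym (toℚᵘ-/ _ (b * d)) ⟩
  toℚᵘ (+ (a * d + c * b) ℚ./ (b * d))    ∎)
  where
  open ℚᵘ.≃-Reasoning
  numerator : + a ℤ.* + d ℤ.+ + c ℤ.* + b ≡ + (a * d + c * b)
  numerator = sym (trans (pos-+ (a * d) (c * b)) (cong₂ ℤ._+_ (pos-* a d) (pos-* c b)))

a/b*c/d≡[a*c]/[b*d] : ∀ a b c d .{{_ : NonZero b}} .{{_ : NonZero d}} →
  (+ a ℚ./ b) *ℚ (+ c ℚ./ d) ≡ (+ (a * c) ℚ./ (b * d)) {{m*n≢0 b d}}
a/b*c/d≡[a*c]/[b*d] a b@(suc _) c d@(suc _) = ℚ.toℚᵘ-injective (begin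
  toℚᵘ ((+ a ℚ./ b) *ℚ (+ c ℚ./ d))      ≈⟨ ℚ.toℚᵘ-homo-* (+ a ℚ./ b) (+ c ℚ./ d) ⟩
  toℚᵘ (+ a ℚ./ b) ℚᵘ.* toℚᵘ (+ c ℚ./ d)  ≈⟨ ℚᵘ.*-cong (toℚᵘ-/ (+ a) b) (toℚᵘ-/ (+ c) d) ⟩
  (+ a ℚᵘ./ b) ℚᵘ.* (+ c ℚᵘ./ d)          ≡⟨ ℚᵘ./-cong (sym (pos-* a c)) refl ⟩
  + (a * c) ℚᵘ./ (b * d)                  ≈⟨ ℚᵘ.≃-sym (toℚᵘ-/ _ (b * d)) ⟩
  toℚᵘ (+ (a * c) ℚ./ (b * d))            ∎)
  where open ℚᵘ.≃-Reasoning

floor-/ : ∀ a b .{{_ : NonZero b}} → floor (+ a ℚ./ b) ≡ + (a / b)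
floor-/ a b@(suc _) = floor-of (toℚᵘ-/ (+ a) b)
  where
  floor-of : ∀ {x} → toℚᵘ x ≃ᵘ + a ℚᵘ./ b → floor x ≡ + (a / b)
  floor-of {mkℚ (+ m) d-1 _} (*≡* eq) =
    trans (div-pos-is-/ℕ (+ m) (suc d-1)) (cong +_ (m*o≡n*p⇒m/p≡n/o m a b (suc d-1) m*b≡a*[1+d-1]))
    where
    m*b≡a*[1+d-1] : m * b ≡ a * suc d-1
    m*b≡a*[1+d-1] = ℤ.+-injective (trans (pos-* m b) (trans eq (sym (pos-* a (suc d-1)))))
  floor-of {mkℚ -[1+ m ] d-1 _} (*≡* eq) with () ← trans (pos-* a (suc d-1)) (sym eq)

frac-/ : ∀ a b .{{_ : NonZero b}} → frac (+ a ℚ./ b) ≡ + (a % b) ℚ./ b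
frac-/ a b@(suc _) = begin
  frac (+ a ℚ./ b)                       ≡⟨ cong (λ z → + a ℚ./ b -ℚ z ℚ./ 1) (floor-/ a b) ⟩
  + a ℚ./ b -ℚ + q ℚ./ 1                 ≡⟨ cong (_-ℚ + q ℚ./ 1) a/b≡r/b+q/1 ⟩
  (+ r ℚ./ b +ℚ + q ℚ./ 1) -ℚ + q ℚ./ 1  ≡⟨ //-rightDividesʳ (+ q ℚ./ 1) (+ r ℚ./ b) ⟩
  + r ℚ./ b                              ∎
  where
  open ≡-Reasoning
  q = a / b
  r = a % b
  rearrange : ∀ r q b → (r + q * b) * (b * 1) ≡ (r * 1 + q * b) * b
  rearrange = ℕ-Solver.solve-∀
  a/b≡r/b+q/1 : + a ℚ./ b ≡ + r ℚ./ b +ℚ + q ℚ./ 1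
  a/b≡r/b+q/1 = trans (a*d≡c*b⇒a/b≡c/d a b (r * 1 + q * b) (b * 1) cross) (sym (a/b+c/d≡[a*d+c*b]/[b*d] r b q 1))
    where
    cross : a * (b * 1) ≡ (r * 1 + q * b) * b
    cross = trans (cong (_* (b * 1)) (m≡m%n+[m/n]*n a b)) (rearrange r q b)

frac[[n+c/D]/p]≡[n%p*D+c]/[p*D] : ∀ n c D p .{{_ : NonZero D}} .{{_ : NonZero p}} .{{_ : NonZero (p * D)}} →
  c < D →
  frac ((ℕ→ℚ n +ℚ + c ℚ./ D) *ℚ (+ 1 ℚ./ p)) ≡ + (n % p * D + c) ℚ./ (p * D)
frac[[n+c/D]/p]≡[n%p*D+c]/[p*D] n c D p c<D = begin
  frac ((+ n ℚ./ 1 +ℚ + c ℚ./ D) *ℚ (+ 1 ℚ./ p))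
    ≡⟨ cong (λ x → frac (x *ℚ (+ 1 ℚ./ p))) (a/b+c/d≡[a*d+c*b]/[b*d] n 1 c D) ⟩
  frac ((+ (n * D + c * 1) ℚ./ (1 * D)) *ℚ (+ 1 ℚ./ p))
    ≡⟨ cong frac (a/b*c/d≡[a*c]/[b*d] (n * D + c * 1) (1 * D) 1 p) ⟩
  frac (+ ((n * D + c * 1) * 1) ℚ./ (1 * D * p))
    ≡⟨ cong frac (a*d≡c*b⇒a/b≡c/d ((n * D + c * 1) * 1) (1 * D * p) (n * D + c) (p * D) (rearrange n c D p)) ⟩
  frac (+ (n * D + c) ℚ./ (p * D))
    ≡⟨ frac-/ (n * D + c) (p * D) ⟩
  + ((n * D + c) % (p * D)) ℚ./ (p * D)
    ≡⟨ ℚ./-cong (cong +_ ([m*n+o]%[p*n]≡m%p*n+o n p c<D)) refl ⟩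
  + (n % p * D + c) ℚ./ (p * D)
    ∎
  where
  open ≡-Reasoning
  instance _ = m*n≢0 1 D
  instance _ = m*n≢0 (1 * D) p
  rearrange : ∀ n c D p → (n * D + c * 1) * 1 * (p * D) ≡ (n * D + c) * (1 * D * p)
  rearrange = ℕ-Solver.solve-∀

1-1/[1+d]≡d/[1+d] : ∀ d → 1ℚ -ℚ inv (suc d) ≡ + d ℚ./ suc d
1-1/[1+d]≡d/[1+d] d = begin
  1ℚ -ℚ + 1 ℚ./ D                            ≡⟨ cong (_-ℚ + 1 ℚ./ D) 1≡d/D+1/D ⟩
  (+ d ℚ./ D +ℚ + 1 ℚ./ D) -ℚ + 1 ℚ./ D      ≡⟨ //-rightDividesʳ (+ 1 ℚ./ D) (+ d ℚ./ D) ⟩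
  + d ℚ./ D                                  ∎
  where
  open ≡-Reasoning
  D = suc d
  1≡d/D+1/D : 1ℚ ≡ + d ℚ./ D +ℚ + 1 ℚ./ D
  1≡d/D+1/D = sym (trans (a/b+c/d≡[a*d+c*b]/[b*d] d D 1 D)
    (a*d≡c*b⇒a/b≡c/d (d * D + 1 * D) (D * D) 1 1 (rearrange d)))
    where
    rearrange : ∀ d → (d * suc d + 1 * suc d) * 1 ≡ 1 * (suc d * suc d)
    rearrange = ℕ-Solver.solve-∀

frac[[n+1-1/D]/p]<1/D : ∀ d n p .{{_ : NonZero p}} → n % p * suc d + d < p →
  frac ((ℕ→ℚ n +ℚ 1ℚ -ℚ inv (suc d)) *ℚ inv p) <ℚ inv (suc d)
frac[[n+1-1/D]/p]<1/D d n p@(suc _) e*D+d<p = begin-strict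
  frac ((ℕ→ℚ n +ℚ 1ℚ -ℚ inv D) *ℚ inv p)  ≡⟨ cong (λ x → frac (x *ℚ inv p)) n+1-1/D≡n+d/D ⟩
  frac ((ℕ→ℚ n +ℚ + d ℚ./ D) *ℚ inv p)   ≡⟨ frac[[n+c/D]/p]≡[n%p*D+c]/[p*D] n d D p (n<1+n d) ⟩
  + (n % p * D + d) ℚ./ (p * D)           <⟨ a*d<c*b⇒a/b<c/d (n % p * D + d) (p * D) 1 D cross ⟩
  + 1 ℚ./ D                               ∎
  where
  open ℚ.≤-Reasoning
  D = suc d
  cross : (n % p * D + d) * D < 1 * (p * D)
  cross = subst ((n % p * D + d) * D <_) (sym (*-identityˡ (p * D))) (*-monoˡ-< D e*D+d<p)
  n+1-1/D≡n+d/D : ℕ→ℚ n +ℚ 1ℚ -ℚ inv D ≡ ℕ→ℚ n +ℚ + d ℚ./ D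
  n+1-1/D≡n+d/D = trans (ℚ.+-assoc (ℕ→ℚ n) 1ℚ (ℚ.- inv D)) (cong (ℕ→ℚ n +ℚ_) (1-1/[1+d]≡d/[1+d] d))

1-1/D≤frac[[n+1/D]/p] : ∀ d n p .{{_ : NonZero p}} → 1 ≤ d → d * p ≤ n % p * suc d + 1 →
  1ℚ -ℚ inv (suc d) ≤ℚ frac ((ℕ→ℚ n +ℚ inv (suc d)) *ℚ inv p)
1-1/D≤frac[[n+1/D]/p] d n p@(suc _) 1≤d d*p≤e*D+1 = begin
  1ℚ -ℚ inv D                             ≡⟨ 1-1/[1+d]≡d/[1+d] d ⟩
  + d ℚ./ D                               ≤⟨ a*d≤c*b⇒a/b≤c/d d D (n % p * D + 1) (p * D) cross ⟩
  + (n % p * D + 1) ℚ./ (p * D)           ≡⟨ frac[[n+c/D]/p]≡[n%p*D+c]/[p*D] n 1 D p (s≤s 1≤d) ⟨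
  frac ((ℕ→ℚ n +ℚ inv D) *ℚ inv p)        ∎
  where
  open ℚ.≤-Reasoning
  D = suc d
  cross : d * (p * D) ≤ (n % p * D + 1) * D
  cross = subst (_≤ (n % p * D + 1) * D) (*-assoc d p D) (*-monoˡ-≤ D d*p≤e*D+1)

FracCondition : ℕ → ℕ → ℕ → Set
FracCondition D n p = frac ((ℕ→ℚ n +ℚ 1ℚ -ℚ inv D) *ℚ inv p) <ℚ inv D
                    ⊎ 1ℚ -ℚ inv D ≤ℚ frac ((ℕ→ℚ n +ℚ inv D) *ℚ inv p)

module _ {d p k : ℕ} (1≤d : 1 ≤ d) (p-prime : Prime p) (D∣p+1 : suc d ∣ p + 1) (p∣Dk+1 : p ∣ suc d * k + 1) where

  private
    instance _ = prime⇒nonZero p-prime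
    D = suc d
    m = _∣_.quotient D∣p+1
    p+1≡m*D : p + 1 ≡ m * D
    p+1≡m*D = _∣_.equality D∣p+1
    b = k % p

    p∣D*b+1 : p ∣ D * b + 1
    p∣D*b+1 = ∣m+n∣m⇒∣n (subst (p ∣_) D*k+1≡D*[k/p]*p+[D*b+1] p∣Dk+1) (n∣m*n (D * (k / p)))
      where
      rearrange : ∀ D b q p → D * (b + q * p) + 1 ≡ D * q * p + (D * b + 1)
      rearrange = ℕ-Solver.solve-∀
      D*k+1≡D*[k/p]*p+[D*b+1] : D * k + 1 ≡ D * (k / p) * p + (D * b + 1)
      D*k+1≡D*[k/p]*p+[D*b+1] = trans (cong (λ k → D * k + 1) (m≡m%n+[m/n]*n k p)) (rearrange D b (k / p) p)

    D*b+1≡d*p : D * b + 1 ≡ d * p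
    D*b+1≡d*p = p∣[1+d]*b+1⇒[1+d]*b+1≡d*p {m = m} 1≤d p+1≡m*D (m%n<n k p) p∣D*b+1

    b+m≡p : b + m ≡ p
    b+m≡p = *-cancelˡ-≡ (b + m) p D (begin
      D * (b + m)      ≡⟨ *-distribˡ-+ D b m ⟩
      D * b + D * m    ≡⟨ cong (λ x → D * b + x) (trans (*-comm D m) (sym p+1≡m*D)) ⟩
      D * b + (p + 1)  ≡⟨ rearrange (D * b) p ⟩
      D * b + 1 + p    ≡⟨ cong (_+ p) D*b+1≡d*p ⟩
      d * p + p        ≡⟨ +-comm (d * p) p ⟩
      D * p            ∎)
      where
      open ≡-Reasoning
      rearrange : ∀ a p → a + (p + 1) ≡ a + 1 + p
      rearrange = ℕ-Solver.solve-∀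

    1+b<p : p ≢ d → suc b < p
    1+b<p p≢d = ≤∧≢⇒< (m%n<n k p) λ 1+b≡p → p≢d (suc-injective (begin
      suc p    ≡⟨ +-comm 1 p ⟩
      p + 1    ≡⟨ p+1≡m*D ⟩
      m * D    ≡⟨ cong (_* D) (+-cancelˡ-≡ b m 1 (trans b+m≡p (trans (sym 1+b≡p) (+-comm 1 b)))) ⟩
      1 * D    ≡⟨ *-identityˡ D ⟩
      D        ∎))
      where open ≡-Reasoning

    m≤1+n%p≤b : ∀ n → ¬ (n % p * D + d < p) → ¬ (d * p ≤ n % p * D + 1) → m ≤ suc (n % p) × n % p < b
    m≤1+n%p≤b n e*D+d≮p d*p≰e*D+1 = m≤1+e , e<b
      where
      open ≤-Reasoning
      e = n % p
      m≤1+e : m ≤ suc e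
      m≤1+e = *-cancelʳ-≤ m (suc e) D (begin
        m * D          ≡⟨ p+1≡m*D ⟨
        p + 1          ≤⟨ +-monoˡ-≤ 1 (≮⇒≥ e*D+d≮p) ⟩
        e * D + d + 1  ≡⟨ rearrange e d ⟩
        suc e * D      ∎)
        where
        rearrange : ∀ e d → e * suc d + d + 1 ≡ suc e * suc d
        rearrange = ℕ-Solver.solve-∀
      e<b : e < b
      e<b = *-cancelʳ-< D e b (+-cancelʳ-< 1 (e * D) (b * D) (begin-strict
        e * D + 1  <⟨ ≰⇒> d*p≰e*D+1 ⟩
        d * p      ≡⟨ D*b+1≡d*p ⟨
        D * b + 1  ≡⟨ cong (_+ 1) (*-comm D b) ⟩
        b * D + 1  ∎))

    frac-condition : ∀ n → ¬ (m ≤ suc (n % p) × n % p < b) → FracCondition D n p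
    frac-condition n outside with n % p * D + d <? p | d * p ≤? n % p * D + 1
    ... | yes e*D+d<p | _            = inj₁ (frac[[n+1-1/D]/p]<1/D d n p e*D+d<p)
    ... | no _        | yes d*p≤e*D+1 = inj₂ (1-1/D≤frac[[n+1/D]/p] d n p 1≤d d*p≤e*D+1)
    ... | no e*D+d≮p  | no d*p≰e*D+1  = contradiction (m≤1+n%p≤b n e*D+d≮p d*p≰e*D+1) outside

    n%p<i%p≤b : ∀ {i n} → i ≤ k → k ≤ n → ¬ p ∣ (n ∸ i) C (k ∸ i) → n % p < b → n % p < i % p × i % p ≤ b
    n%p<i%p≤b i≤k k≤n p∤[n-i]C[k-i] n%p<b = z%n<x%n≤y%n i≤k (≤-trans i≤k k≤n) n%p<b
      (≮⇒≥ (p∤[n-i]C[k-i] ∘ n%p<k%p⇒p∣nCk p-prime))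

  lemma8p3-part₁ : ∀ {i n} → i ≤ k → k ≤ n →
    ¬ p ∣ (k + i) C i → ¬ p ∣ (n ∸ i) C (k ∸ i) → FracCondition D n p
  lemma8p3-part₁ {i} {n} i≤k k≤n p∤[k+i]Ci p∤[n-i]C[k-i] = frac-condition n λ (m≤1+n%p , n%p<b) →
    let n%p<i%p , _ = n%p<i%p≤b i≤k k≤n p∤[n-i]C[k-i] n%p<b
        i%p<m = +-cancelˡ-< b (i % p) m (subst (b + i % p <_) (sym b+m≡p) (≰⇒> (p∤[k+i]Ci ∘ carry)))
    in <⇒≱ n%p<i%p (≤-pred (<-≤-trans i%p<m m≤1+n%p))
    where
    carry : p ≤ b + i % p → p ∣ (k + i) C i
    carry = n%p<k%p⇒p∣nCk p-prime ∘ n≤m%n+o%n⇒[m+o]%n<o%n k i p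

  lemma8p3-part₂ : ∀ {i n} → i ≤ k → k ≤ n → p ≢ d →
    ¬ p ∣ (k + i) C (i + 1) → ¬ p ∣ (n ∸ i) C (k ∸ i) → FracCondition D n p
  lemma8p3-part₂ {i} {n} i≤k k≤n p≢d p∤[k+i]C[i+1] p∤[n-i]C[k-i] = frac-condition n λ (m≤1+n%p , n%p<b) →
    let n%p<i%p , i%p≤b = n%p<i%p≤b i≤k k≤n p∤[n-i]C[k-i] n%p<b
        p≤b+i%p = subst (_≤ b + i % p) b+m≡p (+-monoʳ-≤ b (≤-trans m≤1+n%p n%p<i%p))
        1+i%p<p = ≤-<-trans (s≤s i%p≤b) (1+b<p p≢d)
    in p∤[k+i]C[i+1] (subst (λ j → p ∣ (k + i) C j) (+-comm 1 i) (n%p<k%p⇒p∣nCk p-prime (begin-strict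
         (k + i) % p  <⟨ n≤m%n+o%n⇒[m+o]%n<o%n k i p p≤b+i%p ⟩
         i % p        <⟨ n<1+n (i % p) ⟩
         suc (i % p)  ≡⟨ [1+m]%n≡1+m%n i p 1+i%p<p ⟨
         suc i % p    ∎)))
    where open ≤-Reasoning

2≤D : ∀ {D} → D ≡ 2 ⊎ D ≡ 3 ⊎ D ≡ 4 ⊎ D ≡ 6 → 2 ≤ D
2≤D (inj₁ refl)               = s≤s (s≤s z≤n)
2≤D (inj₂ (inj₁ refl))        = s≤s (s≤s z≤n)
2≤D (inj₂ (inj₂ (inj₁ refl))) = s≤s (s≤s z≤n)
2≤D (inj₂ (inj₂ (inj₂ refl))) = s≤s (s≤s z≤n)

lemma8p3 : (D : ℕ) → (D ≡ 2 ⊎ D ≡ 3 ⊎ D ≡ 4 ⊎ D ≡ 6) →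
    (i n : ℕ) → i ≤ n →
    (p : ℕ) → Prime p → D ∣ p + 1 → 2 * D * n < p * p → p ≤ n →
    (k : ℕ) → i ≤ k → k ≤ n → p ∣ D * k + 1 →
    ((¬ (p ∣ (k + i) C i) → ¬ (p ∣ (n ∸ i) C (k ∸ i)) →
        (frac ((ℕ→ℚ n +ℚ 1ℚ -ℚ inv D) *ℚ inv p) <ℚ inv D
          ⊎ 1ℚ -ℚ inv D ≤ℚ frac ((ℕ→ℚ n +ℚ inv D) *ℚ inv p)))
     ×
     (p ≢ D ∸ 1 → ¬ (p ∣ n + 1) →
        ¬ (p ∣ (k + i) C (i + 1)) → ¬ (p ∣ (n ∸ i) C (k ∸ i)) →
        (frac ((ℕ→ℚ n +ℚ 1ℚ -ℚ inv D) *ℚ inv p) <ℚ inv D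
          ⊎ 1ℚ -ℚ inv D ≤ℚ frac ((ℕ→ℚ n +ℚ inv D) *ℚ inv p))))
lemma8p3 D D∈ i n _ p p-prime D∣p+1 _ _ k i≤k k≤n p∣Dk+1 with 2≤D D∈
... | s≤s 1≤d = lemma8p3-part₁ 1≤d p-prime D∣p+1 p∣Dk+1 i≤k k≤n
              , λ p≢d _ → lemma8p3-part₂ 1≤d p-prime D∣p+1 p∣Dk+1 i≤k k≤n p≢d
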